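{- Let $G$ be a graph that is not complete, and let $\overline{m}$ be the number of unordered pairs of distinct non-adjacent vertices of $G$. Then $$\omega(G)=\min_{\mathcal{D}^1,\ldots,\mathcal{D}^{\overline{m}}\in\mathcal{T}^G}\ \max\Big\{\Big|\bigcap_{j=1}^{\overline{m}} Z^j_{t_j}\Big| : t_j\in V(T^j)\text{ for } j=1,\ldots,\overline{m}\Big\},$$ where $\mathcal{T}^G$ is the set of tree decompositions of $G$ and $\mathcal{D}^j=(T^j,(Z^j_t)_{t\in V(T^j)})$.
   Context: All graphs are finite, simple and undirected; $\omega(G)$ is the clique number of $G$. A tree decomposition of $G$ is a pair $(T,(Z_t)_{t\in V(T)})$ with $T$ a tree and $Z_t\subseteq V(G)$ such that every edge of $G$ has both ends in some $Z_t$, and for every $v\in V(G)$ the set $\{t: v\in Z_t\}$ is non-empty and induces a connected subtree of $T$. -}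

module Defs where

open import Data.Nat using (ℕ; zero; suc; _+_; _<ᵇ_; _≤_)
open import Data.Bool using (Bool; true; false; T; not; _∧_; if_then_else_)
open import Data.Fin using (Fin; toℕ)
open import Data.Fin.Subset using (Subset; _∈_; ∣_∣; ⋂)
open import Data.List using (List; []; _∷_; map; allFin)
open import Data.Nat.ListAction using (sum)
open import Data.Product using (Σ; ∃; _×_; _,_)
open import Relation.Binary.PropositionalEquality using (_≡_; _≢_)
open import Function.Definitions using (Injective)

record Graph (n : ℕ) : Set where
  field
    adj   : Fin n → Fin n → Bool
    sym   : ∀ u v → adj u v ≡ adj v u
    irrefl : ∀ v → adj v v ≡ false
open Graph public

Adj : ∀ {n} → Graph n → Fin n → Fin n → Set
Adj G u v = T (adj G u v)

data WalkIn {n} (G : Graph n) (P : Fin n → Set) : Fin n → Fin n → Set where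
  here  : ∀ {u} → P u → WalkIn G P u u
  step  : ∀ {u w v} → P u → Adj G u w → WalkIn G P w v → WalkIn G P u v

ConnectedIn : ∀ {n} → Graph n → (Fin n → Set) → Set
ConnectedIn G P = ∀ u v → P u → P v → WalkIn G P u v

Connected : ∀ {n} → Graph n → Set
Connected G = ConnectedIn G (λ _ → Data.Unit.⊤)
  where import Data.Unit

-- A cycle of length l + 3: distinct vertices c 0, ..., c (l+2), consecutive
-- ones adjacent, and the last adjacent to the first.
record Cycle {n} (G : Graph n) : Set where
  field
    len   : ℕ
    c     : Fin (3 + len) → Fin n
    inj   : Injective _≡_ _≡_ c
    cons  : ∀ (i : Fin (2 + len)) → Adj G (c (Data.Fin.inject₁ i)) (c (Data.Fin.suc i))
    close : Adj G (c (Data.Fin.fromℕ (2 + len))) (c Data.Fin.zero)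

Acyclic : ∀ {n} → Graph n → Set
Acyclic G = Cycle G → Data.Empty.⊥
  where import Data.Empty

IsTree : ∀ {k} → Graph k → Set
IsTree T = Connected T × Acyclic T

record TreeDecomposition {n} (G : Graph n) : Set₁ where
  field
    size   : ℕ
    tree   : Graph size
    isTree : IsTree tree
    bag    : Fin size → Subset n
    edgeCover : ∀ u v → Adj G u v → ∃ λ t → u ∈ bag t × v ∈ bag t
    vertexNonempty : ∀ v → ∃ λ t → v ∈ bag t
    vertexConnected : ∀ v → ConnectedIn tree (λ t → v ∈ bag t)
open TreeDecomposition public

IsClique : ∀ {n} → Graph n → Subset n → Set
IsClique G S = ∀ u v → u ∈ S → v ∈ S → u ≢ v → Adj G u v

IsCliqueNumber : ∀ {n} → Graph n → ℕ → Set
IsCliqueNumber G ω =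
  (∃ λ S → IsClique G S × ∣ S ∣ ≡ ω) × (∀ S → IsClique G S → ∣ S ∣ ≤ ω)

NotComplete : ∀ {n} → Graph n → Set
NotComplete G = ∃ λ u → ∃ λ v → u ≢ v × adj G u v ≡ false

-- Number of unordered pairs {u,v}, u ≠ v, of non-adjacent vertices
-- (counted as pairs with toℕ u < toℕ v).
nonEdgeCount : ∀ {n} → Graph n → ℕ
nonEdgeCount {n} G =
  sum (map (λ u → sum (map (λ v →
        if (toℕ u <ᵇ toℕ v) ∧ not (adj G u v) then 1 else 0) (allFin n))) (allFin n))

chosenIntersection : ∀ {n} {G : Graph n} {m} (D : Fin m → TreeDecomposition G)
  → ((j : Fin m) → Fin (size (D j))) → Subset n
chosenIntersection {m = m} D t = ⋂ (map (λ j → bag (D j) (t j)) (allFin m))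

-- Lower bound: the bags containing a fixed vertex form a subtree, and pairwise
-- intersecting subtrees of a tree share a node (Helly), so every clique lies in a
-- bag of every tree decomposition; picking such a bag in each of the decompositions
-- gives an intersection of size at least ω.
-- Upper bound: for each non-edge {a, b} take the decomposition with two adjacent
-- bags V − a and V − b. Choosing one bag from each of these leaves out an end of
-- every non-edge, so the intersection is a clique.
module Submission where

open import Defs
open import Data.Bool using (Bool; true; false; T; not; _∧_; if_then_else_)
open import Data.Bool.Properties using (T-∧; T-not-≡)
open import Data.Empty using (⊥; ⊥-elim)
open import Data.Fin using (Fin; zero; suc; toℕ; _<_; fromℕ; inject₁; cast; _≟_)
open import Data.Fin.Properties using (<-cmp; cast-involutive; pigeonhole)
open import Data.Fin.Subset using (Subset; _∈_; _⊆_; ∣_∣; ⋂; ∁; ⁅_⁆)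
open import Data.Fin.Subset.Properties
  using (_∈?_; ∈⊤; x∈p∩q⁺; x∈p∩q⁻; p⊆q⇒∣p∣≤∣q∣; x∈∁p⇒x∉p; x∉p⇒x∈∁p; x≢y⇒x∉⁅y⁆; x∉⁅y⁆⇒x≢y)
open import Data.List
  using (List; []; _∷_; _++_; map; length; lookup; allFin; filterᵇ; cartesianProduct)
open import Data.List.Properties using (map-++; map-∘)
open import Data.List.Membership.Propositional using () renaming (_∈_ to _∈ₗ_; _∉_ to _∉ₗ_)
open import Data.List.Membership.Propositional.Properties
  using (∈-allFin; ∈-lookup; ∈-filter⁺; ∈-filter⁻; ∈-cartesianProduct⁺)
open import Data.List.Relation.Unary.Any using (here; there; index)
open import Data.List.Relation.Unary.Any.Properties using (lookup-index)
open import Data.List.Relation.Unary.All using (All; []; _∷_)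
import Data.List.Relation.Unary.All as All
open import Data.List.Relation.Unary.All.Properties using (map⁺; map⁻; tabulate⁺; tabulate⁻)
open import Data.List.Relation.Unary.AllPairs using ([]; _∷_)
open import Data.List.Relation.Unary.Unique.Propositional using (Unique)
open import Data.List.Relation.Unary.Linked using (Linked; []; [-]; _∷_)
open import Data.Nat using (ℕ; suc; _+_; _<ᵇ_; _≤_; z<s; s<s)
open import Data.Nat.ListAction using (sum)
open import Data.Nat.ListAction.Properties using (sum-++)
open import Data.Nat.Properties using (<ᵇ⇒<; <⇒<ᵇ; <-irrefl)
open import Data.Product using (∃; _×_; _,_; proj₁; proj₂; uncurry)
import Data.Product as Prod
open import Data.Sum using (_⊎_; inj₁; inj₂)
open import Data.Unit using (⊤; tt)
open import Function using (_∘_)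
open import Function.Bundles using (Equivalence)
open import Relation.Binary using (tri<; tri≈; tri>)
open import Relation.Binary.PropositionalEquality
  using (_≡_; _≢_; refl; trans; cong; cong₂; subst; module ≡-Reasoning)
import Relation.Binary.PropositionalEquality as ≡
open import Relation.Nullary using (¬_; yes; no; does)
open import Relation.Nullary.Decidable using (T?)

private
  variable
    A B : Set

lookup-injective : ∀ {xs : List A} → Unique xs → ∀ {i j} → lookup xs i ≡ lookup xs j → i ≡ j
lookup-injective (_  ∷ _)    {zero}  {zero}  _ = refl
lookup-injective (x∉ ∷ _)    {zero}  {suc j} e = ⊥-elim (All.lookup x∉ (∈-lookup j) e)
lookup-injective (x∉ ∷ _)    {suc i} {zero}  e = ⊥-elim (All.lookup x∉ (∈-lookup i) (≡.sym e))
lookup-injective (_  ∷ uniq) {suc i} {suc j} e = cong suc (lookup-injective uniq e)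

Linked-lookup : ∀ {R : A → A → Set} {x xs} → Linked R (x ∷ xs) →
  ∀ i → R (lookup (x ∷ xs) (inject₁ i)) (lookup xs i)
Linked-lookup (r ∷ _)      zero    = r
Linked-lookup (_ ∷ linked) (suc i) = Linked-lookup linked i

length-filterᵇ : ∀ (p : A → Bool) xs →
  length (filterᵇ p xs) ≡ sum (map (λ x → if p x then 1 else 0) xs)
length-filterᵇ p []       = refl
length-filterᵇ p (x ∷ xs) with p x
... | true  = cong suc (length-filterᵇ p xs)
... | false = length-filterᵇ p xs

sum-map-cartesianProduct : ∀ (f : A × B → ℕ) xs ys →
  sum (map f (cartesianProduct xs ys)) ≡ sum (map (λ x → sum (map (λ y → f (x , y)) ys)) xs)
sum-map-cartesianProduct f []       ys = refl
sum-map-cartesianProduct f (x ∷ xs) ys = begin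
  sum (map f (map (x ,_) ys ++ cartesianProduct xs ys))
    ≡⟨ cong sum (map-++ f (map (x ,_) ys) _) ⟩
  sum (map f (map (x ,_) ys) ++ map f (cartesianProduct xs ys))
    ≡⟨ sum-++ (map f (map (x ,_) ys)) _ ⟩
  sum (map f (map (x ,_) ys)) + sum (map f (cartesianProduct xs ys))
    ≡⟨ cong₂ _+_ (cong sum (≡.sym (map-∘ ys))) (sum-map-cartesianProduct f xs ys) ⟩
  sum (map (λ y → f (x , y)) ys) + sum (map (λ x → sum (map (λ y → f (x , y)) ys)) xs) ∎
  where open ≡-Reasoning

x∈⋂⁺ : ∀ {n} {x : Fin n} {ps} → All (x ∈_) ps → x ∈ ⋂ ps
x∈⋂⁺ []             = ∈⊤
x∈⋂⁺ (x∈p ∷ x∈⋂ps) = x∈p∩q⁺ (x∈p , x∈⋂⁺ x∈⋂ps)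

x∈⋂⁻ : ∀ {n} {x : Fin n} ps → x ∈ ⋂ ps → All (x ∈_) ps
x∈⋂⁻ []       _   = []
x∈⋂⁻ (p ∷ ps) x∈ = let x∈p , x∈⋂ps = x∈p∩q⁻ p (⋂ ps) x∈ in x∈p ∷ x∈⋂⁻ ps x∈⋂ps

x≢y⇒x∈∁⁅y⁆ : ∀ {n} {x y : Fin n} → x ≢ y → x ∈ ∁ ⁅ y ⁆
x≢y⇒x∈∁⁅y⁆ = x∉p⇒x∈∁p ∘ x≢y⇒x∉⁅y⁆

x∈∁⁅y⁆⇒x≢y : ∀ {n} {x y : Fin n} → x ∈ ∁ ⁅ y ⁆ → x ≢ y
x∈∁⁅y⁆⇒x≢y = x∉⁅y⁆⇒x≢y ∘ x∈∁p⇒x∉p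

module _ {n} {G : Graph n} {m} (D : Fin m → TreeDecomposition G) where

  ∈-chosenIntersection⁺ : ∀ {t x} → (∀ j → x ∈ bag (D j) (t j)) → x ∈ chosenIntersection D t
  ∈-chosenIntersection⁺ x∈bags = x∈⋂⁺ (map⁺ (tabulate⁺ x∈bags))

  ∈-chosenIntersection⁻ : ∀ t {x} → x ∈ chosenIntersection D t → ∀ j → x ∈ bag (D j) (t j)
  ∈-chosenIntersection⁻ t x∈ = tabulate⁻ (map⁻ (x∈⋂⁻ _ x∈))

module _ {n} (G : Graph n) where

  Adj-sym : ∀ {u v} → Adj G u v → Adj G v u
  Adj-sym {u} {v} = subst T (Graph.sym G u v)

  data PathIn (P : Fin n → Set) : Fin n → Fin n → List (Fin n) → Set where
    [_]  : ∀ {u} → P u → PathIn P u u []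
    cons : ∀ {u w v xs} → P u → Adj G u w → u ∉ₗ w ∷ xs → PathIn P w v xs → PathIn P u v (w ∷ xs)

module _ {n} {G : Graph n} where

  open import Data.List.Membership.DecPropositional (_≟_ {n}) using () renaming (_∈?_ to _∈ₗ?_)

  _++ʷ_ : ∀ {P u w v} → WalkIn G P u w → WalkIn G P w v → WalkIn G P u v
  here _        ++ʷ q = q
  step pu a r   ++ʷ q = step pu a (r ++ʷ q)

  walk-start : ∀ {P u v} → WalkIn G P u v → P u
  walk-start (here pu)     = pu
  walk-start (step pu _ _) = pu

  reverseʷ : ∀ {P u v} → WalkIn G P u v → WalkIn G P v u
  reverseʷ (here pu)     = here pu
  reverseʷ (step pu a r) = reverseʷ r ++ʷ step (walk-start r) (Adj-sym G a) (here pu)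

  mapʷ : ∀ {P Q : Fin n → Set} {u v} → (∀ {s} → P s → Q s) → WalkIn G P u v → WalkIn G Q u v
  mapʷ f (here pu)     = here (f pu)
  mapʷ f (step pu a r) = step (f pu) a (mapʷ f r)

  PathIn-from : ∀ {P u w v xs} → u ∈ₗ w ∷ xs → PathIn G P w v xs → ∃ λ ys → PathIn G P u v ys
  PathIn-from (here refl) p              = _ , p
  PathIn-from (there u∈)  (cons _ _ _ p) = PathIn-from u∈ p

  walk⇒path : ∀ {P u v} → WalkIn G P u v → ∃ λ xs → PathIn G P u v xs
  walk⇒path (here pu) = _ , [ pu ]
  walk⇒path {u = u} (step {w = w} pu a r) with walk⇒path r
  ... | xs , p with u ∈ₗ? (w ∷ xs)
  ...   | yes u∈ = PathIn-from u∈ p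
  ...   | no  u∉ = _ , cons pu a u∉ p

  path⇒walk : ∀ {P Q u v xs} → PathIn G P u v xs → (∀ {s} → s ∈ₗ u ∷ xs → Q s) → WalkIn G Q u v
  path⇒walk [ _ ]          Q-all = here (Q-all (here refl))
  path⇒walk (cons _ a _ p) Q-all = step (Q-all (here refl)) a (path⇒walk p (Q-all ∘ there))

  PathIn-All : ∀ {P u v xs} → PathIn G P u v xs → All P (u ∷ xs)
  PathIn-All [ pu ]          = pu ∷ []
  PathIn-All (cons pu _ _ p) = pu ∷ PathIn-All p

  PathIn-Unique : ∀ {P u v xs} → PathIn G P u v xs → Unique (u ∷ xs)
  PathIn-Unique [ _ ]           = [] ∷ []
  PathIn-Unique (cons _ _ u∉ p) = ∉⇒All≢ u∉ ∷ PathIn-Unique p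
    where
    ∉⇒All≢ : ∀ {u : Fin n} {xs} → u ∉ₗ xs → All (u ≢_) xs
    ∉⇒All≢ {xs = []}     _  = []
    ∉⇒All≢ {xs = _ ∷ _} u∉ = (u∉ ∘ here) ∷ ∉⇒All≢ (u∉ ∘ there)

  PathIn-Linked : ∀ {P u v xs} → PathIn G P u v xs → Linked (Adj G) (u ∷ xs)
  PathIn-Linked [ _ ]          = [-]
  PathIn-Linked (cons _ a _ p) = a ∷ PathIn-Linked p

  PathIn-last : ∀ {P u v xs} → PathIn G P u v xs → lookup (u ∷ xs) (fromℕ (length xs)) ≡ v
  PathIn-last [ _ ]          = refl
  PathIn-last (cons _ _ _ p) = PathIn-last p

module _ {n} {G : Graph n} (acyclic : Acyclic G) where

  private
    cycle-through : ∀ {t z w y xs} → Adj G t z → Adj G t y → z ≢ t → Adj G z w → z ∉ₗ w ∷ xs →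
      PathIn G (_≢ t) w y xs → ⊥
    cycle-through {t} {z} {w} {y} {xs} t~z t~y z≢t z~w z∉ p = acyclic record
      { len   = length xs
      ; c     = lookup cycle
      ; inj   = lookup-injective distinct
      ; cons  = Linked-lookup (t~z ∷ z~w ∷ PathIn-Linked p)
      ; close = subst (λ s → Adj G s t) (≡.sym (PathIn-last p)) (Adj-sym G t~y)
      }
      where
      cycle = t ∷ z ∷ w ∷ xs
      t∉ : All (t ≢_) (z ∷ w ∷ xs)
      t∉ = All.map (λ s≢t → s≢t ∘ ≡.sym) (z≢t ∷ PathIn-All p)
      distinct : Unique cycle
      distinct = t∉ ∷ PathIn-Unique (cons z≢t z~w z∉ p)

  neighbours-joined-avoiding⇒≡ : ∀ {t z y} → Adj G t z → Adj G t y → WalkIn G (_≢ t) z y → z ≡ y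
  neighbours-joined-avoiding⇒≡ t~z t~y walk with walk⇒path walk
  ... | _ , [ _ ]             = refl
  ... | _ , cons z≢t z~w z∉ p = ⊥-elim (cycle-through t~z t~y z≢t z~w z∉ p)

  private
    last-departure : ∀ {P t t′ a x} → Adj G t t′ → WalkIn G P a x → WalkIn G (_≢ t) x t′ →
      P t′ ⊎ WalkIn G (_≢ t) a t′
    last-departure t~t′ (here _)   back = inj₂ back
    last-departure {P} {t} t~t′ (step {u = a} _ a~d rest) back with last-departure t~t′ rest back
    ... | inj₁ Pt′  = inj₁ Pt′
    ... | inj₂ d→t′ with a ≟ t
    ...   | no  a≢t  = inj₂ (step a≢t a~d d→t′)
    ...   | yes refl = inj₁ (subst P (neighbours-joined-avoiding⇒≡ a~d t~t′ d→t′) (walk-start rest))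

  -- The walk from t to x leaves t for the last time through t′.
  route-neighbour-∈ : ∀ {P t t′ x} → Adj G t t′ → WalkIn G P t x → WalkIn G (_≢ t) x t′ → P t′
  route-neighbour-∈ t~t′ to-x from-x with last-departure t~t′ to-x from-x
  ... | inj₁ Pt′  = Pt′
  ... | inj₂ t→t′ = ⊥-elim (walk-start t→t′ refl)

-- Cliques lie in bags of tree decompositions

module _ {n} {G : Graph n} (D : TreeDecomposition G) where

  -- Walking from c towards a bag of v, every u ∈ R survives a step c → c′ while v ∉ c:
  -- u's subtree joins c to a bag shared with v, from which v's subtree (missing c)
  -- and the rest of the path lead to c′ avoiding c.
  bag-towards : ∀ {R : Fin n → Set} {v c w xs} → (∀ {u} → R u → u ≢ v → Adj G u v) →
    PathIn (tree D) (λ _ → ⊤) c w xs → v ∈ bag D w → (∀ {u} → R u → u ∈ bag D c) →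
    ∃ λ t → v ∈ bag D t × (∀ {u} → R u → u ∈ bag D t)
  bag-towards R~v [ _ ] v∈w R⊆c = _ , v∈w , R⊆c
  bag-towards {R} {v} {c} {w} R~v (cons {w = c′} _ c~c′ c∉ p) v∈w R⊆c with v ∈? bag D c
  ... | yes v∈c = c , v∈c , R⊆c
  ... | no  v∉c = bag-towards R~v p v∈w R⊆c′
    where
    R⊆c′ : ∀ {u} → R u → u ∈ bag D c′
    R⊆c′ {u} Ru = route-neighbour-∈ (proj₂ (isTree D)) c~c′ c→x (x→w ++ʷ w→c′)
      where
      u∈c = R⊆c Ru
      shared = edgeCover D u v (R~v Ru λ { refl → v∉c u∈c })
      x = proj₁ shared
      c→x = vertexConnected D u c x u∈c (proj₁ (proj₂ shared))
      x→w : WalkIn (tree D) (_≢ c) x w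
      x→w = mapʷ (λ { {s} v∈s refl → v∉c v∈s })
        (vertexConnected D v x w (proj₂ (proj₂ shared)) v∈w)
      w→c′ : WalkIn (tree D) (_≢ c) w c′
      w→c′ = reverseʷ (path⇒walk p λ { s∈ refl → c∉ s∈ })

  clique⊆bag : ∀ {K} → IsClique G K → Fin (size D) → ∃ λ t → K ⊆ bag D t
  clique⊆bag {K} K-clique t₀ = Prod.map₂ (λ K⊆t x∈K → K⊆t (∈-allFin _) x∈K) (extend (allFin n))
    where
    extend : (vs : List (Fin n)) → ∃ λ t → ∀ {u} → u ∈ₗ vs → u ∈ K → u ∈ bag D t
    extend []       = t₀ , λ ()
    extend (v ∷ vs) with extend vs | v ∈? K
    ... | t , vs⊆t | no v∉K = t , λ { (here refl) v∈K → ⊥-elim (v∉K v∈K) ; (there u∈) → vs⊆t u∈ }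
    ... | t , vs⊆t | yes v∈K =
      let w , v∈w = vertexNonempty D v
          _ , t→w = walk⇒path (proj₁ (isTree D) t w tt tt)
          t′ , v∈t′ , vs⊆t′ = bag-towards (λ (_ , u∈K) u≢v → K-clique _ v u∈K v∈K u≢v)
                                t→w v∈w (λ (u∈ , u∈K) → vs⊆t u∈ u∈K)
      in t′ , λ { (here refl) _ → v∈t′ ; (there u∈) u∈K → vs⊆t′ (u∈ , u∈K) }

clique⊆chosenIntersection : ∀ {n} {G : Graph n} {m} (D : Fin m → TreeDecomposition G) →
  Fin n → ∀ {K} → IsClique G K → ∃ λ t → K ⊆ chosenIntersection D t
clique⊆chosenIntersection D u₀ K-clique =
  (proj₁ ∘ choice) , λ x∈K → ∈-chosenIntersection⁺ D λ j → proj₂ (choice j) x∈K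
  where
  choice = λ j → clique⊆bag (D j) K-clique (proj₁ (vertexNonempty (D j) u₀))

-- The decomposition of a non-edge

K₂ : Graph 2
K₂ = record
  { adj    = λ u v → not (does (u ≟ v))
  ; sym    = λ { zero zero → refl ; zero (suc zero) → refl
               ; (suc zero) zero → refl ; (suc zero) (suc zero) → refl }
  ; irrefl = λ { zero → refl ; (suc zero) → refl }
  }

K₂-connectedIn : ∀ P → ConnectedIn K₂ P
K₂-connectedIn P zero       zero       pu pv = here pu
K₂-connectedIn P zero       (suc zero) pu pv = step pu tt (here pv)
K₂-connectedIn P (suc zero) zero       pu pv = step pu tt (here pv)
K₂-connectedIn P (suc zero) (suc zero) pu pv = here pu

order2-acyclic : (H : Graph 2) → Acyclic H
order2-acyclic H cycle =
  let i , j , i<j , cᵢ≡cⱼ = pigeonhole (s<s (s<s z<s)) c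
  in <-irrefl (cong toℕ (inj cᵢ≡cⱼ)) i<j
  where open Cycle cycle

module _ {n} (a b : Fin n) where

  nonEdgeBag : Fin 2 → Subset n
  nonEdgeBag zero       = ∁ ⁅ a ⁆
  nonEdgeBag (suc zero) = ∁ ⁅ b ⁆

  nonEdgeBag-separates : ∀ s → a ∈ nonEdgeBag s → b ∈ nonEdgeBag s → ⊥
  nonEdgeBag-separates zero       a∈ _  = x∈∁⁅y⁆⇒x≢y a∈ refl
  nonEdgeBag-separates (suc zero) _  b∈ = x∈∁⁅y⁆⇒x≢y b∈ refl

module _ {n} (G : Graph n) {a b : Fin n} (a≢b : a ≢ b) (a≁b : adj G a b ≡ false) where

  nonEdgeDecomposition : TreeDecomposition G
  nonEdgeDecomposition = record
    { size            = 2
    ; tree            = K₂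
    ; isTree          = K₂-connectedIn _ , order2-acyclic K₂
    ; bag             = nonEdgeBag a b
    ; edgeCover       = edge-covered
    ; vertexNonempty  = vertex-covered
    ; vertexConnected = λ _ → K₂-connectedIn _
    }
    where
    ¬a~b : ¬ Adj G a b
    ¬a~b = subst T a≁b

    edge-covered : ∀ u v → Adj G u v → ∃ λ s → u ∈ nonEdgeBag a b s × v ∈ nonEdgeBag a b s
    edge-covered u v u~v with u ≟ a | v ≟ a
    ... | no u≢a | no v≢a = zero , x≢y⇒x∈∁⁅y⁆ u≢a , x≢y⇒x∈∁⁅y⁆ v≢a
    ... | yes refl | _    = suc zero , x≢y⇒x∈∁⁅y⁆ a≢b , x≢y⇒x∈∁⁅y⁆ λ { refl → ¬a~b u~v }
    ... | no _ | yes refl = suc zero , x≢y⇒x∈∁⁅y⁆ (λ { refl → ¬a~b (Adj-sym G u~v) }) , x≢y⇒x∈∁⁅y⁆ a≢b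

    vertex-covered : ∀ v → ∃ λ s → v ∈ nonEdgeBag a b s
    vertex-covered v with v ≟ a
    ... | no  v≢a  = zero , x≢y⇒x∈∁⁅y⁆ v≢a
    ... | yes refl = suc zero , x≢y⇒x∈∁⁅y⁆ a≢b

module _ {n} (G : Graph n) where

  isNonEdgeᵇ : Fin n → Fin n → Bool
  isNonEdgeᵇ u v = (toℕ u <ᵇ toℕ v) ∧ not (adj G u v)

  isNonEdgeᵇ⁻ : ∀ {u v} → T (isNonEdgeᵇ u v) → u ≢ v × adj G u v ≡ false
  isNonEdgeᵇ⁻ {u} {v} ok =
    let u<v , u≁v = Equivalence.to T-∧ ok
    in (λ { refl → <-irrefl refl (<ᵇ⇒< (toℕ u) (toℕ v) u<v) }) , Equivalence.to T-not-≡ u≁v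

  nonEdges : List (Fin n × Fin n)
  nonEdges = filterᵇ (uncurry isNonEdgeᵇ) (cartesianProduct (allFin n) (allFin n))

  length-nonEdges : length nonEdges ≡ nonEdgeCount G
  length-nonEdges = trans
    (length-filterᵇ (uncurry isNonEdgeᵇ) (cartesianProduct (allFin n) (allFin n)))
    (sum-map-cartesianProduct (λ (u , v) → if isNonEdgeᵇ u v then 1 else 0) (allFin n) (allFin n))

  nonEdge : Fin (nonEdgeCount G) → Fin n × Fin n
  nonEdge j = lookup nonEdges (cast (≡.sym length-nonEdges) j)

  nonEdge-isNonEdge : ∀ j → T (uncurry isNonEdgeᵇ (nonEdge j))
  nonEdge-isNonEdge j =
    proj₂ (∈-filter⁻ (T? ∘ uncurry isNonEdgeᵇ) {xs = cartesianProduct (allFin n) (allFin n)} (∈-lookup _))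

  ordered-nonEdge : ∀ {u v} → u < v → adj G u v ≡ false → ∃ λ j → (u , v) ≡ nonEdge j
  ordered-nonEdge {u} {v} u<v u≁v = cast length-nonEdges (index uv∈) , (begin
    (u , v)
      ≡⟨ lookup-index uv∈ ⟩
    lookup nonEdges (index uv∈)
      ≡⟨ cong (lookup nonEdges) (cast-involutive (≡.sym length-nonEdges) length-nonEdges (index uv∈)) ⟨
    nonEdge (cast length-nonEdges (index uv∈)) ∎)
    where
    open ≡-Reasoning
    uv∈ = ∈-filter⁺ (T? ∘ uncurry isNonEdgeᵇ) (∈-cartesianProduct⁺ (∈-allFin u) (∈-allFin v))
            (Equivalence.from T-∧ (<⇒<ᵇ u<v , Equivalence.from T-not-≡ u≁v))

  nonEdge-complete : ∀ {u v} → u ≢ v → adj G u v ≡ false →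
    ∃ λ j → (u , v) ≡ nonEdge j ⊎ (v , u) ≡ nonEdge j
  nonEdge-complete {u} {v} u≢v u≁v with <-cmp u v
  ... | tri< u<v _ _ = Prod.map₂ inj₁ (ordered-nonEdge u<v u≁v)
  ... | tri≈ _ u≡v _ = ⊥-elim (u≢v u≡v)
  ... | tri> _ _ v<u = Prod.map₂ inj₂ (ordered-nonEdge v<u (trans (Graph.sym G v u) u≁v))

  nonEdgeDecompositions : Fin (nonEdgeCount G) → TreeDecomposition G
  nonEdgeDecompositions j =
    let u≢v , u≁v = isNonEdgeᵇ⁻ (nonEdge-isNonEdge j) in nonEdgeDecomposition G u≢v u≁v

  private
    nonEdge-separated : ∀ t j {u v} → (u , v) ≡ nonEdge j →
      u ∈ chosenIntersection nonEdgeDecompositions t →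
      v ∈ chosenIntersection nonEdgeDecompositions t → ⊥
    nonEdge-separated t j refl u∈ v∈ = nonEdgeBag-separates _ _ (t j)
      (∈-chosenIntersection⁻ nonEdgeDecompositions t u∈ j)
      (∈-chosenIntersection⁻ nonEdgeDecompositions t v∈ j)

  chosenIntersection-isClique : ∀ t → IsClique G (chosenIntersection nonEdgeDecompositions t)
  chosenIntersection-isClique t u v u∈ v∈ u≢v with adj G u v in u≁v
  ... | true  = tt
  ... | false with nonEdge-complete u≢v u≁v
  ...   | j , inj₁ uv≡ = nonEdge-separated t j uv≡ u∈ v∈
  ...   | j , inj₂ vu≡ = nonEdge-separated t j vu≡ v∈ u∈

theorem5p8 : ∀ {n} (G : Graph n) → NotComplete G → (ω : ℕ) → IsCliqueNumber G ω →
    ((∀ (D : Fin (nonEdgeCount G) → TreeDecomposition G) →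
        ∃ λ (t : (j : Fin (nonEdgeCount G)) → Fin (size (D j))) →
          ω ≤ ∣ chosenIntersection D t ∣)
    × (∃ λ (D : Fin (nonEdgeCount G) → TreeDecomposition G) →
        ∀ (t : (j : Fin (nonEdgeCount G)) → Fin (size (D j))) →
          ∣ chosenIntersection D t ∣ ≤ ω))
theorem5p8 G (u₀ , _) ω ((K , K-clique , ∣K∣≡ω) , maximal) = lower-bound , upper-bound
  where
  lower-bound = λ D →
    let t , K⊆ = clique⊆chosenIntersection D u₀ K-clique
    in t , subst (_≤ _) ∣K∣≡ω (p⊆q⇒∣p∣≤∣q∣ K⊆)
  upper-bound = nonEdgeDecompositions G , λ t → maximal _ (chosenIntersection-isClique G t)
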